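{- The healthiness function $\mathbf{R}$ on predicates is idempotent and monotonic: $\mathbf{R} = \mathbf{R} \circ \mathbf{R}$, and for all predicates $P, Q$, $P \sqsubseteq Q$ implies $\mathbf{R}(P) \sqsubseteq \mathbf{R}(Q)$.
   Context: Fix a trace algebra $(\mathcal{T}, \frown, \langle\rangle)$: a set with associative $\frown$, two-sided unit $\langle\rangle$, left and right cancellation ($x\frown y = x \frown z \Rightarrow y = z$, $x \frown z = y \frown z \Rightarrow x = y$), and $x \frown y = \langle\rangle \Rightarrow x = \langle\rangle$. Prefix: $x \le y \iff \exists z.\ y = x \frown z$; subtraction: $y - x$ is the unique $z$ with $y = x \frown z$ if $x \le y$, else $\langle\rangle$. Predicates are relations (formulas identified up to logical equivalence) over unprimed variables $v$ and primed variables $v'$, where the variables include observational variables $wait, wait' : \mathbb{B}$ and $tr, tr' : \mathcal{T}$ plus arbitrary further state variables. Refinement: $P \sqsubseteq Q$ iff $Q \Rightarrow P$ holds for all variable values. Conditional: $P \lhd b \rhd Q \triangleq (b \land P) \lor (\lnot b \land Q)$. Skip $\mathit{II}$ is the predicate $v' = v$ for all variables. Healthiness functions: $\mathbf{R1}(P) \triangleq P \land tr \le tr'$; $\mathbf{R2}_c(P) \triangleq P[\langle\rangle, tr' - tr / tr, tr'] \lhd tr \le tr' \rhd P$ (simultaneous substitution); $\mathbf{R3}(P) \triangleq \mathit{II} \lhd wait \rhd P$; $\mathbf{R} \triangleq \mathbf{R3} \circ \mathbf{R2}_c \circ \mathbf{R1}$. -}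

module Defs where

open import Level using (Level; _⊔_)
open import Data.Bool using (Bool; true; false; T)
open import Data.Product using (Σ; _×_; _,_)
open import Data.Sum using (_⊎_)
open import Relation.Nullary using (¬_)
open import Relation.Binary.PropositionalEquality using (_≡_)

-- Prefix order and subtraction are as in the paper; subtraction is given as
-- an operation together with its defining specification (it is uniquely
-- determined by the other axioms; constructively we cannot define it by
-- case distinction on the undecidable relation ≤, so it is carried as data).
record TraceAlgebra (ℓ : Level) : Set (Level.suc ℓ) where
  infixr 6 _⌢_
  infix 4 _≼_
  field
    Trace   : Set ℓ
    _⌢_     : Trace → Trace → Trace
    ⟨⟩      : Trace
    assoc   : ∀ x y z → (x ⌢ y) ⌢ z ≡ x ⌢ (y ⌢ z)
    unitˡ   : ∀ x → ⟨⟩ ⌢ x ≡ x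
    unitʳ   : ∀ x → x ⌢ ⟨⟩ ≡ x
    cancelˡ : ∀ x y z → x ⌢ y ≡ x ⌢ z → y ≡ z
    cancelʳ : ∀ x y z → x ⌢ z ≡ y ⌢ z → x ≡ y
    emptyˡ  : ∀ x y → x ⌢ y ≡ ⟨⟩ → x ≡ ⟨⟩

  _≼_ : Trace → Trace → Set ℓ
  x ≼ y = Σ Trace (λ z → y ≡ x ⌢ z)

  field
    _∸_      : Trace → Trace → Trace
    ∸-prefix : ∀ x y → x ≼ y → y ≡ x ⌢ (y ∸ x)
    ∸-other  : ∀ x y → ¬ (x ≼ y) → y ∸ x ≡ ⟨⟩

module Reactive {ℓ : Level} (TA : TraceAlgebra ℓ) (S : Set ℓ) where
  open TraceAlgebra TA

  record State : Set ℓ where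
    constructor mkState
    field
      wait : Bool
      tr   : Trace
      st   : S
  open State public

  -- predicate over unprimed (first) and primed (second) variables
  Pred : Set (Level.suc ℓ)
  Pred = State → State → Set ℓ

  _⊑_ : Pred → Pred → Set ℓ
  P ⊑ Q = ∀ v v' → Q v v' → P v v'

  _≐_ : Pred → Pred → Set ℓ
  P ≐ Q = ∀ v v' → (P v v' → Q v v') × (Q v v' → P v v')

  _◁_▷_ : Pred → (State → State → Set ℓ) → Pred → Pred
  (P ◁ b ▷ Q) v v' = (b v v' × P v v') ⊎ (¬ b v v' × Q v v')

  II : Pred
  II v v' = v' ≡ v

  trPrefix : State → State → Set ℓ
  trPrefix v v' = tr v ≼ tr v'

  isWait : State → State → Set ℓ
  isWait v v' = Lift ℓ (T (wait v))
    where open import Level using (Lift)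

  R1 : Pred → Pred
  R1 P v v' = P v v' × tr v ≼ tr v'

  R2subst : Pred → Pred
  R2subst P v v' = P (record v { tr = ⟨⟩ }) (record v' { tr = tr v' ∸ tr v })

  R2c : Pred → Pred
  R2c P = R2subst P ◁ trPrefix ▷ P

  R3 : Pred → Pred
  R3 P = II ◁ isWait ▷ P

  R : Pred → Pred
  R P = R3 (R2c (R1 P))

-- R is a composite of three monotone operators, so it is monotone.  For
-- idempotence, R3 only inspects its argument when wait is false, and there
-- R2c ∘ R1 amounts to "tr ≤ tr' and P holds of the traces rebased at ⟨⟩".
-- Rebasing twice is rebasing once (y - ⟨⟩ = y), and a rebased trace
-- always extends ⟨⟩, so applying R a second time adds no constraint.
module Submission where

open import Defs
open import Level using (Level; suc)
open import Data.Product using (_×_; _,_; proj₁)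
open import Data.Product.Function.NonDependent.Propositional using (_×-⇔_)
open import Data.Sum using (inj₁; inj₂)
open import Function using (_⇔_; mk⇔; Equivalence; id)
open import Function.Construct.Identity using (⇔-id)
open import Function.Construct.Symmetry using (⇔-sym)
open import Function.Related.Propositional using (module EquationalReasoning; equivalence)
open import Relation.Nullary using (¬_; contradiction)
open import Relation.Binary.PropositionalEquality using (_≡_; refl; sym; trans; cong; subst)

module TraceAlgebraProperties {ℓ : Level} (TA : TraceAlgebra ℓ) where
  open TraceAlgebra TA

  ⟨⟩-≼ : ∀ x → ⟨⟩ ≼ x
  ⟨⟩-≼ x = x , sym (unitˡ x)

  x∸⟨⟩≡x : ∀ x → x ∸ ⟨⟩ ≡ x
  x∸⟨⟩≡x x = sym (trans (∸-prefix ⟨⟩ x (⟨⟩-≼ x)) (unitˡ (x ∸ ⟨⟩)))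

module ReactiveProperties {ℓ : Level} (TA : TraceAlgebra ℓ) (S : Set ℓ) where
  open TraceAlgebra TA
  open TraceAlgebraProperties TA
  open Reactive TA S
  open EquationalReasoning {k = equivalence}

  Monotone : (Pred → Pred) → Set (suc ℓ)
  Monotone F = ∀ P Q → P ⊑ Q → F P ⊑ F Q

  ◁▷-mono : ∀ {P P′ Q Q′} b → P ⊑ P′ → Q ⊑ Q′ → (P ◁ b ▷ Q) ⊑ (P′ ◁ b ▷ Q′)
  ◁▷-mono b P⊑P′ Q⊑Q′ v v' (inj₁ (c , p)) = inj₁ (c , P⊑P′ v v' p)
  ◁▷-mono b P⊑P′ Q⊑Q′ v v' (inj₂ (¬c , q)) = inj₂ (¬c , Q⊑Q′ v v' q)

  R1-mono : Monotone R1
  R1-mono P Q P⊑Q v v' (q , pre) = P⊑Q v v' q , pre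

  R2subst-mono : Monotone R2subst
  R2subst-mono P Q P⊑Q v v' = P⊑Q _ _

  R2c-mono : Monotone R2c
  R2c-mono P Q P⊑Q = ◁▷-mono trPrefix (R2subst-mono P Q P⊑Q) P⊑Q

  R3-mono-¬wait : ∀ {P Q} → (∀ v v' → ¬ isWait v v' → Q v v' → P v v') → R3 P ⊑ R3 Q
  R3-mono-¬wait Q⇒P v v' (inj₁ skip) = inj₁ skip
  R3-mono-¬wait Q⇒P v v' (inj₂ (¬w , q)) = inj₂ (¬w , Q⇒P v v' ¬w q)

  R3-mono : Monotone R3
  R3-mono P Q P⊑Q = R3-mono-¬wait (λ v v' _ → P⊑Q v v')

  R-mono : Monotone R
  R-mono P Q P⊑Q = R3-mono _ _ (R2c-mono _ _ (R1-mono P Q P⊑Q))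

  R3-cong-¬wait : ∀ {P Q} → (∀ v v' → ¬ isWait v v' → P v v' ⇔ Q v v') → R3 P ≐ R3 Q
  R3-cong-¬wait P⇔Q v v' = R3-mono-¬wait (λ v v' ¬w → Equivalence.to (P⇔Q v v' ¬w)) v v'
                         , R3-mono-¬wait (λ v v' ¬w → Equivalence.from (P⇔Q v v' ¬w)) v v'

  R3-¬wait : ∀ P v v' → ¬ isWait v v' → R3 P v v' ⇔ P v v'
  R3-¬wait P v v' ¬w = mk⇔ from-R3 (λ p → inj₂ (¬w , p))
    where
    from-R3 : R3 P v v' → P v v'
    from-R3 (inj₁ (w , _)) = contradiction w ¬w
    from-R3 (inj₂ (_ , p)) = p

  R1-from-⟨⟩ : ∀ P v v' → tr v ≡ ⟨⟩ → R1 P v v' ⇔ P v v'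
  R1-from-⟨⟩ P v v' tr≡⟨⟩ = mk⇔ proj₁ (λ p → p , subst (_≼ tr v') (sym tr≡⟨⟩) (⟨⟩-≼ (tr v')))

  R2c-R1 : ∀ P v v' → R2c (R1 P) v v' ⇔ R1 (R2subst P) v v'
  R2c-R1 P v v' = mk⇔ to (λ (p , pre) → inj₁ (pre , p , ⟨⟩-≼ _))
    where
    to : R2c (R1 P) v v' → R1 (R2subst P) v v'
    to (inj₁ (pre , p , _)) = p , pre
    to (inj₂ (¬pre , _ , pre)) = contradiction pre ¬pre

  R2subst-idem : ∀ P v v' → R2subst (R2subst P) v v' ⇔ R2subst P v v'
  R2subst-idem P v v' = mk⇔ (subst (P _) rebase) (subst (P _) (sym rebase))
    where
    rebase : mkState (wait v') ((tr v' ∸ tr v) ∸ ⟨⟩) (st v') ≡ mkState (wait v') (tr v' ∸ tr v) (st v')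
    rebase = cong (λ t → mkState (wait v') t (st v')) (x∸⟨⟩≡x (tr v' ∸ tr v))

  R2subst-R : ∀ P v v' → ¬ isWait v v' → R2subst (R P) v v' ⇔ R2subst P v v'
  -- Rebasing leaves wait untouched, so ¬w also applies to the rebased pair v₀ v₁.
  R2subst-R P v v' ¬w = begin
    R2subst (R P) v v'                 ∼⟨ R3-¬wait (R2c (R1 P)) v₀ v₁ ¬w ⟩
    R2subst (R2c (R1 P)) v v'          ∼⟨ R2c-R1 P v₀ v₁ ⟩
    R2subst (R1 (R2subst P)) v v'      ∼⟨ R1-from-⟨⟩ (R2subst P) v₀ v₁ refl ⟩
    R2subst (R2subst P) v v'           ∼⟨ R2subst-idem P v v' ⟩
    R2subst P v v'                     ∎
    where
    v₀ v₁ : State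
    v₀ = record v { tr = ⟨⟩ }
    v₁ = record v' { tr = tr v' ∸ tr v }

  R-idem : ∀ P → R P ≐ R (R P)
  R-idem P = R3-cong-¬wait λ v v' ¬w → begin
    R2c (R1 P) v v'                    ∼⟨ R2c-R1 P v v' ⟩
    R1 (R2subst P) v v'                ∼⟨ ⇔-sym (R2subst-R P v v' ¬w) ×-⇔ ⇔-id _ ⟩
    R1 (R2subst (R P)) v v'            ∼⟨ ⇔-sym (R2c-R1 (R P) v v') ⟩
    R2c (R1 (R P)) v v'                ∎

theorem8 : ∀ {ℓ : Level} (TA : TraceAlgebra ℓ) (S : Set ℓ) →
    let open Reactive TA S in
    (∀ (P : Pred) → R P ≐ R (R P)) × (∀ (P Q : Pred) → P ⊑ Q → R P ⊑ R Q)
theorem8 TA S = R-idem , R-mono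
  where open ReactiveProperties TA S
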